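{- Let $p\in(0,1)$, $q=1-p$, and $m\ge 1$. Let $U_m$ be the $(m+1)\times(m+1)$ upper triangular matrix indexed by $0\le i,j\le m$ with $(U_m)_{ij}=\binom{m-i}{j-i}p^{m+1-j}q^{j-i}$. Let $P_m$ be the $(m+1)\times(m+1)$ matrix with $(P_m)_{ij}=\binom{m-i}{j-i}$. Then $P_m$ is a modal matrix of $U_m$, i.e., $P_m$ is invertible and each of its columns is an eigenvector of $U_m$, and its inverse is given by $(P_m^{ -1})_{ij}=(-1)^{i-j}\binom{m-i}{j-i}$.
   Context: Binomial coefficients $\binom{a}{b}$ are taken to be $0$ when $b<0$ or $b>a$. Indices of matrices run from $0$ to $m$. -}

module Defs where

open import Level using (_⊔_)
open import Data.Nat using (ℕ; suc; _∸_; _<ᵇ_; _≡ᵇ_)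
open import Data.Nat.Combinatorics using (_C_)
open import Data.Fin using (Fin; toℕ)
open import Data.Bool using (if_then_else_)
open import Data.Product using (Σ; ∃; _×_)
open import Relation.Nullary using (¬_)
open import Algebra.Bundles using (CommutativeRing)
import Algebra.Bundles

-- binom m i j = C(m - i, j - i), taken to be 0 when j - i < 0 (i.e. j < i).
-- (Indices i ≤ m always, so m ∸ i is the true difference; `_C_` is already 0
-- when the lower index exceeds the upper one.)
binom : ℕ → ℕ → ℕ → ℕ
binom m i j = if j <ᵇ i then 0 else (m ∸ i) C (j ∸ i)

module Matrices {c ℓ} (R : CommutativeRing c ℓ) where
  open CommutativeRing R
  open import Algebra.Definitions.RawSemiring (Algebra.Bundles.Semiring.rawSemiring semiring) using (sum; _^_) renaming (_×_ to _·ℕ_)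

  Mat : ℕ → Set c
  Mat n = Fin n → Fin n → Carrier

  _⊗_ : ∀ {n} → Mat n → Mat n → Mat n
  (A ⊗ B) i j = sum (λ k → A i k * B k j)

  _≈ᴹ_ : ∀ {n} → Mat n → Mat n → Set ℓ
  A ≈ᴹ B = ∀ i j → A i j ≈ B i j

  𝟙 : ∀ {n} → Mat n
  𝟙 i j = if toℕ i ≡ᵇ toℕ j then 1# else 0#

  _⊙_ : ∀ {n} → Mat n → (Fin n → Carrier) → (Fin n → Carrier)
  (A ⊙ v) i = sum (λ k → A i k * v k)

  IsInvertible : ∀ {n} → Mat n → Set (c ⊔ ℓ)
  IsInvertible {n} A = Σ (Mat n) (λ B → (A ⊗ B) ≈ᴹ 𝟙 × (B ⊗ A) ≈ᴹ 𝟙)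

  IsEigenvector : ∀ {n} → Mat n → (Fin n → Carrier) → Set (c ⊔ ℓ)
  IsEigenvector A v = (¬ (∀ i → v i ≈ 0#)) × ∃ (λ μ → ∀ i → (A ⊙ v) i ≈ μ * v i)

  IsModalMatrix : ∀ {n} → Mat n → Mat n → Set (c ⊔ ℓ)
  IsModalMatrix A P = IsInvertible P × (∀ j → IsEigenvector A (λ i → P i j))

  U : (m : ℕ) → Carrier → Carrier → Mat (suc m)
  U m p q i j = binom m (toℕ i) (toℕ j) ·ℕ (p ^ (suc m ∸ toℕ j) * q ^ (toℕ j ∸ toℕ i))

  P : (m : ℕ) → Mat (suc m)
  P m i j = binom m (toℕ i) (toℕ j) ·ℕ 1#

  -- (P_m^{-1})_{ij} = (-1)^{i-j} C(m-i, j-i); the entry is 0 unless j ≥ i,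
  -- and then (-1)^{i-j} = (-1)^{j-i}.
  Pinv : (m : ℕ) → Mat (suc m)
  Pinv m i j = ((- 1#) ^ (toℕ j ∸ toℕ i)) * (binom m (toℕ i) (toℕ j) ·ℕ 1#)

{-# OPTIONS --safe #-}
module Submission where

-- Write s = j - i.  The identity C(m-i, k-i) C(m-k, j-k) = C(m-i, j-i) C(s, k-i) for i ≤ k ≤ j
-- turns entry (i, j) of each of the products P Pinv, Pinv P and U P into C(m-i, j-i) times a
-- binomial expansion ∑ₗ C(s, l) xˡ yˢ⁻ˡ = (x + y)ˢ.  For P Pinv and Pinv P, {x, y} = {1, -1}, so
-- the entry is C(m-i, j-i) 0ˢ, the Kronecker delta.  For U P, x = q and y = p with an extra factor
-- p^(m+1-j), so q + p = 1 leaves p^(m+1-j) P_ij: column j of P is an eigenvector for p^(m+1-j),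
-- and it is nonzero because P_jj = 1.

open import Defs
open import Data.Nat using (ℕ; _≥_)
open import Data.Product using (_×_; _,_)
open import Relation.Nullary using (¬_)
open import Algebra.Bundles using (CommutativeRing)

open import Data.Bool using (if_then_else_)
open import Relation.Nullary using (yes; no)
open import Relation.Nullary.Decidable using (dec-true; dec-false)

module BinomialCoefficients where

  open import Data.Nat
  open import Data.Nat.Properties
  open import Data.Nat.Combinatorics using (_C_; nCk≡n!/k![n-k]!; k![n∸k]!∣n!)
  open import Data.Nat.DivMod using (m/n*n≡m)
  open import Data.Nat.Tactic.RingSolver using (solve-∀)
  open import Relation.Binary.PropositionalEquality
  open ≡-Reasoning

  nCk*k![n∸k]!≡n! : ∀ {n k} → k ≤ n → (n C k) * (k ! * (n ∸ k) !) ≡ n !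
  nCk*k![n∸k]!≡n! {n} {k} k≤n =
    trans (cong (_* (k ! * (n ∸ k) !)) (nCk≡n!/k![n-k]! k≤n)) (m/n*n≡m (k![n∸k]!∣n! k≤n))
    where instance _ = k !* (n ∸ k) !≢0

  nCl*[n∸l]C[s∸l]≡nCs*sCl : ∀ {n s l} → l ≤ s → s ≤ n →
                            (n C l) * ((n ∸ l) C (s ∸ l)) ≡ (n C s) * (s C l)
  nCl*[n∸l]C[s∸l]≡nCs*sCl {n} {s} {l} l≤s s≤n =
    *-cancelʳ-≡ _ _ (l ! * ((s ∸ l) ! * (n ∸ s) !)) (begin
      (n C l) * ((n ∸ l) C (s ∸ l)) * (l ! * ((s ∸ l) ! * (n ∸ s) !))
        ≡⟨ regroupˡ (n C l) ((n ∸ l) C (s ∸ l)) (l !) ((s ∸ l) !) ((n ∸ s) !) ⟩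
      (n C l) * (l ! * (((n ∸ l) C (s ∸ l)) * ((s ∸ l) ! * (n ∸ s) !)))
        ≡⟨ cong (λ r → (n C l) * (l ! * (((n ∸ l) C (s ∸ l)) * ((s ∸ l) ! * r !))))
                [n∸l]∸[s∸l]≡n∸s ⟨
      (n C l) * (l ! * (((n ∸ l) C (s ∸ l)) * ((s ∸ l) ! * ((n ∸ l) ∸ (s ∸ l)) !)))
        ≡⟨ cong (λ r → (n C l) * (l ! * r)) (nCk*k![n∸k]!≡n! (∸-monoˡ-≤ l s≤n)) ⟩
      (n C l) * (l ! * (n ∸ l) !)
        ≡⟨ nCk*k![n∸k]!≡n! (≤-trans l≤s s≤n) ⟩
      n !
        ≡⟨ nCk*k![n∸k]!≡n! s≤n ⟨
      (n C s) * (s ! * (n ∸ s) !)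
        ≡⟨ cong (λ r → (n C s) * (r * (n ∸ s) !)) (nCk*k![n∸k]!≡n! l≤s) ⟨
      (n C s) * ((s C l) * (l ! * (s ∸ l) !) * (n ∸ s) !)
        ≡⟨ regroupʳ (n C s) (s C l) (l !) ((s ∸ l) !) ((n ∸ s) !) ⟩
      (n C s) * (s C l) * (l ! * ((s ∸ l) ! * (n ∸ s) !)) ∎)
    where
    instance _ = m*n≢0 (l !) ((s ∸ l) ! * (n ∸ s) !) {{l !≢0}} {{(s ∸ l) !* (n ∸ s) !≢0}}
    [n∸l]∸[s∸l]≡n∸s : (n ∸ l) ∸ (s ∸ l) ≡ n ∸ s
    [n∸l]∸[s∸l]≡n∸s = trans (∸-+-assoc n l (s ∸ l)) (cong (n ∸_) (m+[n∸m]≡n l≤s))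
    regroupˡ : ∀ a b x y z → a * b * (x * (y * z)) ≡ a * (x * (b * (y * z)))
    regroupˡ = solve-∀
    regroupʳ : ∀ a b x y z → a * (b * (x * y) * z) ≡ a * b * (x * (y * z))
    regroupʳ = solve-∀

  binom-< : ∀ m {i j} → j < i → binom m i j ≡ 0
  binom-< m {i} {j} j<i = cong (λ b → if b then 0 else (m ∸ i) C (j ∸ i)) (dec-true (j <? i) j<i)

  binom-≥ : ∀ m {i j} → i ≤ j → binom m i j ≡ (m ∸ i) C (j ∸ i)
  binom-≥ m {i} {j} i≤j =
    cong (λ b → if b then 0 else (m ∸ i) C (j ∸ i)) (dec-false (j <? i) (≤⇒≯ i≤j))

  binom-diag : ∀ m i → binom m i i ≡ 1
  binom-diag m i = trans (binom-≥ m (≤-refl {i})) (cong ((m ∸ i) C_) (n∸n≡0 i))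

  binom-+ : ∀ m i l → binom m i (i + l) ≡ (m ∸ i) C l
  binom-+ m i l = trans (binom-≥ m (m≤m+n i l)) (cong ((m ∸ i) C_) (m+n∸m≡n i l))

  binom-*-binom : ∀ {m i j} l → i + l ≤ j → j ≤ m →
                  binom m i (i + l) * binom m (i + l) j ≡ binom m i j * ((j ∸ i) C l)
  binom-*-binom {m} {i} {j} l i+l≤j j≤m = begin
      binom m i (i + l) * binom m (i + l) j
        ≡⟨ cong₂ _*_ (binom-+ m i l) (binom-≥ m i+l≤j) ⟩
      ((m ∸ i) C l) * ((m ∸ (i + l)) C (j ∸ (i + l)))
        ≡⟨ cong₂ (λ a b → ((m ∸ i) C l) * (a C b)) (∸-+-assoc m i l) (∸-+-assoc j i l) ⟨
      ((m ∸ i) C l) * (((m ∸ i) ∸ l) C ((j ∸ i) ∸ l))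
        ≡⟨ nCl*[n∸l]C[s∸l]≡nCs*sCl l≤j∸i (∸-monoˡ-≤ i j≤m) ⟩
      ((m ∸ i) C (j ∸ i)) * ((j ∸ i) C l)
        ≡⟨ cong (_* ((j ∸ i) C l)) (binom-≥ m (m+n≤o⇒m≤o i i+l≤j)) ⟨
      binom m i j * ((j ∸ i) C l) ∎
    where
    l≤j∸i : l ≤ j ∸ i
    l≤j∸i = m+n≤o⇒m≤o∸n l (≤-trans (≤-reflexive (+-comm l i)) i+l≤j)

  binom-*-binom-< : ∀ {m i j} k → j < i → binom m i k * binom m k j ≡ 0
  binom-*-binom-< {m} {i} {j} k j<i with k <? i
  ... | yes k<i = cong (_* binom m k j) (binom-< m k<i)
  ... | no  k≮i =
    trans (cong (binom m i k *_) (binom-< m (<-≤-trans j<i (≮⇒≥ k≮i)))) (*-zeroʳ (binom m i k))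

module BinomialMatrices {c ℓ} (R : CommutativeRing c ℓ) where

  open import Data.Nat as ℕ using (zero; suc; _∸_; _≤_; _<_; _≡ᵇ_; s≤s)
  open import Data.Nat.Properties as ℕ
    using (m≤n⇒∃[o]m+o≡n; m≤m+n; ≤-trans; ≤-reflexive; +-suc; +-monoʳ-≤; m+[n∸m]≡n; m+n∸m≡n;
           n∸n≡0; ∸-+-assoc; +-∸-comm; m≤n⇒m≤1+n; ≰⇒>; <-cmp; _≤?_; _≟_)
  open import Data.Nat.Combinatorics using (_C_)
  open import Data.Fin using (Fin; toℕ)
  open import Data.Fin.Properties using (toℕ<n; toℕ≤pred[n])
  open import Relation.Binary.Definitions using (tri<; tri≈; tri>)
  open import Relation.Binary.PropositionalEquality as ≡ using (_≡_; _≢_)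
  open BinomialCoefficients

  open CommutativeRing R
  open Matrices R
  open import Algebra.Definitions.RawSemiring (Algebra.Bundles.Semiring.rawSemiring semiring)
    using (sum; _^_) renaming (_×_ to _·ℕ_)
  open import Algebra.Properties.Semiring.Sum semiring
    using (sum-cong-≋; sum-replicate-zero; *-distribˡ-sum; *-distribʳ-sum)
  open import Algebra.Properties.Semiring.Mult semiring using (×-assoc-*; ×1-homo-*; ×-congʳ; ×-homo-1)
  open import Algebra.Properties.Semiring.Exp semiring using (^-homo-*; ^-congˡ)
  open import Algebra.Properties.CommutativeSemigroup *-commutativeSemigroup
    using (x∙yz≈xz∙y; xy∙z≈yz∙x; xy∙z≈xz∙y; xy∙z≈zx∙y)
  import Algebra.Properties.CommutativeSemiring.Binomial commutativeSemiring as Binomial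
  open import Relation.Binary.Reasoning.Setoid setoid

  -- Opaque so that ∑ (suc n) f does not unfold to a Fin-sum, from which f could not be inferred.
  opaque
    ∑ : ℕ → (ℕ → Carrier) → Carrier
    ∑ n f = sum {n} (λ k → f (toℕ k))

    sum≡∑ : ∀ n (f : ℕ → Carrier) → sum {n} (λ k → f (toℕ k)) ≡ ∑ n f
    sum≡∑ n f = ≡.refl

    ∑-cong : ∀ n {f g : ℕ → Carrier} → (∀ k → k < n → f k ≈ g k) → ∑ n f ≈ ∑ n g
    ∑-cong n f≈g = sum-cong-≋ (λ k → f≈g (toℕ k) (toℕ<n k))

    ∑-zero : ∀ n {f : ℕ → Carrier} → (∀ k → k < n → f k ≈ 0#) → ∑ n f ≈ 0#
    ∑-zero n f≈0 = trans (∑-cong n f≈0) (sum-replicate-zero n)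

    ∑-+ : ∀ a b (f : ℕ → Carrier) → ∑ (a ℕ.+ b) f ≈ ∑ a f + ∑ b (λ k → f (a ℕ.+ k))
    ∑-+ zero    b f = sym (+-identityˡ _)
    ∑-+ (suc a) b f = trans (+-congˡ (∑-+ a b (λ k → f (suc k)))) (sym (+-assoc _ _ _))

    *-distribˡ-∑ : ∀ n x (f : ℕ → Carrier) → x * ∑ n f ≈ ∑ n (λ k → x * f k)
    *-distribˡ-∑ n x f = *-distribˡ-sum {n} x (λ k → f (toℕ k))

    *-distribʳ-∑ : ∀ n x (f : ℕ → Carrier) → ∑ n f * x ≈ ∑ n (λ k → f k * x)
    *-distribʳ-∑ n x f = *-distribʳ-sum {n} x (λ k → f (toℕ k))

  ∑-support : ∀ {N} i n (f : ℕ → Carrier) → i ℕ.+ n ≤ N →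
              (∀ k → k < i → f k ≈ 0#) → (∀ k → i ℕ.+ n ≤ k → f k ≈ 0#) →
              ∑ N f ≈ ∑ n (λ l → f (i ℕ.+ l))
  ∑-support i n f i+n≤N below above with m≤n⇒∃[o]m+o≡n i+n≤N
  ... | r , ≡.refl = begin
    ∑ (i ℕ.+ n ℕ.+ r) f
      ≈⟨ ∑-+ (i ℕ.+ n) r f ⟩
    ∑ (i ℕ.+ n) f + ∑ r (λ t → f (i ℕ.+ n ℕ.+ t))
      ≈⟨ +-cong (∑-+ i n f) (∑-zero r (λ t _ → above _ (m≤m+n _ t))) ⟩
    ∑ i f + ∑ n (λ l → f (i ℕ.+ l)) + 0#
      ≈⟨ +-identityʳ _ ⟩
    ∑ i f + ∑ n (λ l → f (i ℕ.+ l))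
      ≈⟨ +-congʳ (∑-zero i below) ⟩
    0# + ∑ n (λ l → f (i ℕ.+ l))
      ≈⟨ +-identityˡ _ ⟩
    ∑ n (λ l → f (i ℕ.+ l)) ∎

  ι : ℕ → Carrier
  ι n = n ·ℕ 1#

  ×≈ι* : ∀ n x → n ·ℕ x ≈ ι n * x
  ×≈ι* n x = sym (trans (×-assoc-* n 1# x) (×-congʳ n (*-identityˡ x)))

  1^n≈1 : ∀ n → 1# ^ n ≈ 1#
  1^n≈1 zero    = refl
  1^n≈1 (suc n) = trans (*-identityˡ _) (1^n≈1 n)

  0^[b∸a]≈0 : ∀ {a b} → a < b → 0# ^ (b ∸ a) ≈ 0#
  0^[b∸a]≈0 {zero}  {suc b} _          = zeroˡ _
  0^[b∸a]≈0 {suc a} {suc b} (s≤s a<b) = 0^[b∸a]≈0 a<b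

  binomial-theorem : ∀ s x y → ∑ (suc s) (λ l → ι (s C l) * (x ^ l * y ^ (s ∸ l))) ≈ (x + y) ^ s
  binomial-theorem s x y = sym (begin
    (x + y) ^ s
      ≈⟨ Binomial.theorem s x y ⟩
    Binomial.binomialExpansion x y s
      ≡⟨ sum≡∑ (suc s) (λ l → (s C l) ·ℕ (x ^ l * y ^ (s ∸ l))) ⟩
    ∑ (suc s) (λ l → (s C l) ·ℕ (x ^ l * y ^ (s ∸ l)))
      ≈⟨ ∑-cong (suc s) (λ l _ → ×≈ι* (s C l) (x ^ l * y ^ (s ∸ l))) ⟩
    ∑ (suc s) (λ l → ι (s C l) * (x ^ l * y ^ (s ∸ l))) ∎)

  -- 𝟙 i j unfolds to δ (toℕ i) (toℕ j).
  δ : ℕ → ℕ → Carrier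
  δ a b = if a ≡ᵇ b then 1# else 0#

  δ-refl : ∀ a → δ a a ≡ 1#
  δ-refl a = ≡.cong (λ t → if t then 1# else 0#) (dec-true (a ≟ a) ≡.refl)

  δ-≢ : ∀ {a b} → a ≢ b → δ a b ≡ 0#
  δ-≢ {a} {b} a≢b = ≡.cong (λ t → if t then 1# else 0#) (dec-false (a ≟ b) a≢b)

  ι-binom*0^≈δ : ∀ m a b → ι (binom m a b) * 0# ^ (b ∸ a) ≈ δ a b
  ι-binom*0^≈δ m a b with <-cmp a b
  ... | tri< a<b a≢b _ = begin
    ι (binom m a b) * 0# ^ (b ∸ a) ≈⟨ *-congˡ (0^[b∸a]≈0 a<b) ⟩
    ι (binom m a b) * 0#           ≈⟨ zeroʳ _ ⟩
    0#                             ≡⟨ δ-≢ a≢b ⟨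
    δ a b                          ∎
  ... | tri≈ _ ≡.refl _ = begin
    ι (binom m a a) * 0# ^ (a ∸ a) ≡⟨ ≡.cong₂ (λ n e → ι n * 0# ^ e) (binom-diag m a) (n∸n≡0 a) ⟩
    ι 1 * 1#                       ≈⟨ *-identityʳ _ ⟩
    ι 1                            ≈⟨ ×-homo-1 1# ⟩
    1#                             ≡⟨ δ-refl a ⟨
    δ a a                          ∎
  ... | tri> _ a≢b b<a = begin
    ι (binom m a b) * 0# ^ (b ∸ a) ≡⟨ ≡.cong (λ n → ι n * 0# ^ (b ∸ a)) (binom-< m b<a) ⟩
    0# * 0# ^ (b ∸ a)              ≈⟨ zeroˡ _ ⟩
    0#                             ≡⟨ δ-≢ a≢b ⟨
    δ a b                          ∎

  ι-binom*-cong : ∀ m a b {x y} → (a ≤ b → x ≈ y) → ι (binom m a b) * x ≈ ι (binom m a b) * y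
  ι-binom*-cong m a b x≈y with a ≤? b
  ... | yes a≤b = *-congˡ (x≈y a≤b)
  ... | no  a≰b rewrite binom-< m (≰⇒> a≰b) = trans (zeroˡ _) (sym (zeroˡ _))

  ∑-binom-binom-≤ : ∀ {m i j} → i ≤ j → j ≤ m → (w : ℕ → Carrier) →
                    ∑ (suc m) (λ k → ι (binom m i k) * ι (binom m k j) * w k)
                      ≈ ι (binom m i j) * ∑ (suc (j ∸ i)) (λ l → ι ((j ∸ i) C l) * w (i ℕ.+ l))
  ∑-binom-binom-≤ {m} {i} {j} i≤j j≤m w = begin
    ∑ (suc m) F
      ≈⟨ ∑-support i (suc s) F (≤-trans (≤-reflexive i+[1+s]≡1+j) (s≤s j≤m)) below above ⟩
    ∑ (suc s) (λ l → F (i ℕ.+ l))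
      ≈⟨ ∑-cong (suc s) window ⟩
    ∑ (suc s) (λ l → ι (binom m i j) * (ι (s C l) * w (i ℕ.+ l)))
      ≈⟨ *-distribˡ-∑ (suc s) (ι (binom m i j)) (λ l → ι (s C l) * w (i ℕ.+ l)) ⟨
    ι (binom m i j) * ∑ (suc s) (λ l → ι (s C l) * w (i ℕ.+ l)) ∎
    where
    s = j ∸ i
    F : ℕ → Carrier
    F k = ι (binom m i k) * ι (binom m k j) * w k

    i+[1+s]≡1+j : i ℕ.+ suc s ≡ suc j
    i+[1+s]≡1+j = ≡.trans (+-suc i s) (≡.cong suc (m+[n∸m]≡n i≤j))

    below : ∀ k → k < i → F k ≈ 0#
    below k k<i rewrite binom-< m k<i = trans (*-congʳ (zeroˡ _)) (zeroˡ (w k))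

    above : ∀ k → i ℕ.+ suc s ≤ k → F k ≈ 0#
    above k i+[1+s]≤k rewrite binom-< m (≤-trans (≤-reflexive (≡.sym i+[1+s]≡1+j)) i+[1+s]≤k) =
      trans (*-congʳ (zeroʳ _)) (zeroˡ (w k))

    window : ∀ l → l < suc s → F (i ℕ.+ l) ≈ ι (binom m i j) * (ι (s C l) * w (i ℕ.+ l))
    window l (s≤s l≤s) = begin
      ι (binom m i (i ℕ.+ l)) * ι (binom m (i ℕ.+ l) j) * w (i ℕ.+ l)
        ≈⟨ *-congʳ (×1-homo-* (binom m i (i ℕ.+ l)) (binom m (i ℕ.+ l) j)) ⟨
      ι (binom m i (i ℕ.+ l) ℕ.* binom m (i ℕ.+ l) j) * w (i ℕ.+ l)
        ≡⟨ ≡.cong (λ n → ι n * w (i ℕ.+ l)) (binom-*-binom l i+l≤j j≤m) ⟩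
      ι (binom m i j ℕ.* (s C l)) * w (i ℕ.+ l)
        ≈⟨ *-congʳ (×1-homo-* (binom m i j) (s C l)) ⟩
      ι (binom m i j) * ι (s C l) * w (i ℕ.+ l)
        ≈⟨ *-assoc _ _ _ ⟩
      ι (binom m i j) * (ι (s C l) * w (i ℕ.+ l)) ∎
      where
      i+l≤j : i ℕ.+ l ≤ j
      i+l≤j = ≤-trans (+-monoʳ-≤ i l≤s) (≤-reflexive (m+[n∸m]≡n i≤j))

  ∑-binom-binom : ∀ {m i j} → j ≤ m → (w : ℕ → Carrier) →
                  ∑ (suc m) (λ k → ι (binom m i k) * ι (binom m k j) * w k)
                    ≈ ι (binom m i j) * ∑ (suc (j ∸ i)) (λ l → ι ((j ∸ i) C l) * w (i ℕ.+ l))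
  ∑-binom-binom {m} {i} {j} j≤m w with i ≤? j
  ... | yes i≤j = ∑-binom-binom-≤ i≤j j≤m w
  ... | no  i≰j = begin
    ∑ (suc m) (λ k → ι (binom m i k) * ι (binom m k j) * w k)
      ≈⟨ ∑-zero (suc m) (λ k _ → vanishes k) ⟩
    0#
      ≈⟨ zeroˡ _ ⟨
    0# * ∑ (suc (j ∸ i)) (λ l → ι ((j ∸ i) C l) * w (i ℕ.+ l))
      ≡⟨ ≡.cong (λ n → ι n * _) (binom-< m j<i) ⟨
    ι (binom m i j) * ∑ (suc (j ∸ i)) (λ l → ι ((j ∸ i) C l) * w (i ℕ.+ l)) ∎
    where
    j<i : j < i
    j<i = ≰⇒> i≰j
    vanishes : ∀ k → ι (binom m i k) * ι (binom m k j) * w k ≈ 0#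
    vanishes k = begin
      ι (binom m i k) * ι (binom m k j) * w k   ≈⟨ *-congʳ (×1-homo-* (binom m i k) (binom m k j)) ⟨
      ι (binom m i k ℕ.* binom m k j) * w k     ≡⟨ ≡.cong (λ n → ι n * w k) (binom-*-binom-< k j<i) ⟩
      0# * w k                                  ≈⟨ zeroˡ (w k) ⟩
      0#                                        ∎

  ∑-binom-binom-binomial : ∀ {m i j} → j ≤ m → ∀ x y (w : ℕ → Carrier) →
                           (∀ l → l ≤ j ∸ i → w (i ℕ.+ l) ≈ x ^ l * y ^ (j ∸ i ∸ l)) →
                           ∑ (suc m) (λ k → ι (binom m i k) * ι (binom m k j) * w k)
                             ≈ ι (binom m i j) * (x + y) ^ (j ∸ i)
  ∑-binom-binom-binomial {m} {i} {j} j≤m x y w w≈ =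
    trans (∑-binom-binom j≤m w)
          (*-congˡ (trans (∑-cong (suc (j ∸ i)) (λ { l (s≤s l≤s) → *-congˡ (w≈ l l≤s) }))
                          (binomial-theorem (j ∸ i) x y)))

  P⊗Pinv≈𝟙 : ∀ m → (P m ⊗ Pinv m) ≈ᴹ 𝟙
  P⊗Pinv≈𝟙 m i j = begin
    (P m ⊗ Pinv m) i j
      ≡⟨ sum≡∑ (suc m) _ ⟩
    ∑ (suc m) (λ k → ι (binom m a k) * ((- 1#) ^ (b ∸ k) * ι (binom m k b)))
      ≈⟨ ∑-cong (suc m) (λ k _ → x∙yz≈xz∙y _ _ _) ⟩
    ∑ (suc m) (λ k → ι (binom m a k) * ι (binom m k b) * (- 1#) ^ (b ∸ k))
      ≈⟨ ∑-binom-binom-binomial {i = a} (toℕ≤pred[n] j) 1# (- 1#) (λ k → (- 1#) ^ (b ∸ k)) sign ⟩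
    ι (binom m a b) * (1# - 1#) ^ (b ∸ a)
      ≈⟨ *-congˡ (^-congˡ (b ∸ a) (-‿inverseʳ 1#)) ⟩
    ι (binom m a b) * 0# ^ (b ∸ a)
      ≈⟨ ι-binom*0^≈δ m a b ⟩
    δ a b ∎
    where
    a = toℕ i
    b = toℕ j
    sign : ∀ l → l ≤ b ∸ a → (- 1#) ^ (b ∸ (a ℕ.+ l)) ≈ 1# ^ l * (- 1#) ^ (b ∸ a ∸ l)
    sign l _ = begin
      (- 1#) ^ (b ∸ (a ℕ.+ l))      ≡⟨ ≡.cong ((- 1#) ^_) (∸-+-assoc b a l) ⟨
      (- 1#) ^ (b ∸ a ∸ l)          ≈⟨ *-identityˡ _ ⟨
      1# * (- 1#) ^ (b ∸ a ∸ l)     ≈⟨ *-congʳ (1^n≈1 l) ⟨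
      1# ^ l * (- 1#) ^ (b ∸ a ∸ l) ∎

  Pinv⊗P≈𝟙 : ∀ m → (Pinv m ⊗ P m) ≈ᴹ 𝟙
  Pinv⊗P≈𝟙 m i j = begin
    (Pinv m ⊗ P m) i j
      ≡⟨ sum≡∑ (suc m) _ ⟩
    ∑ (suc m) (λ k → (- 1#) ^ (k ∸ a) * ι (binom m a k) * ι (binom m k b))
      ≈⟨ ∑-cong (suc m) (λ k _ → xy∙z≈yz∙x _ _ _) ⟩
    ∑ (suc m) (λ k → ι (binom m a k) * ι (binom m k b) * (- 1#) ^ (k ∸ a))
      ≈⟨ ∑-binom-binom-binomial {i = a} (toℕ≤pred[n] j) (- 1#) 1# (λ k → (- 1#) ^ (k ∸ a)) sign ⟩
    ι (binom m a b) * (- 1# + 1#) ^ (b ∸ a)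
      ≈⟨ *-congˡ (^-congˡ (b ∸ a) (-‿inverseˡ 1#)) ⟩
    ι (binom m a b) * 0# ^ (b ∸ a)
      ≈⟨ ι-binom*0^≈δ m a b ⟩
    δ a b ∎
    where
    a = toℕ i
    b = toℕ j
    sign : ∀ l → l ≤ b ∸ a → (- 1#) ^ (a ℕ.+ l ∸ a) ≈ (- 1#) ^ l * 1# ^ (b ∸ a ∸ l)
    sign l _ = begin
      (- 1#) ^ (a ℕ.+ l ∸ a)         ≡⟨ ≡.cong ((- 1#) ^_) (m+n∸m≡n a l) ⟩
      (- 1#) ^ l                     ≈⟨ *-identityʳ _ ⟨
      (- 1#) ^ l * 1#                ≈⟨ *-congˡ (1^n≈1 (b ∸ a ∸ l)) ⟨
      (- 1#) ^ l * 1# ^ (b ∸ a ∸ l)  ∎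

  module _ {p q : Carrier} (q≈1-p : q ≈ 1# - p) where

    q+p≈1 : q + p ≈ 1#
    q+p≈1 = begin
      q + p          ≈⟨ +-congʳ q≈1-p ⟩
      1# - p + p     ≈⟨ +-assoc 1# (- p) p ⟩
      1# + (- p + p) ≈⟨ +-congˡ (-‿inverseˡ p) ⟩
      1# + 0#        ≈⟨ +-identityʳ 1# ⟩
      1#             ∎

    ∑-U-window : ∀ m {a b} → a ≤ b → b ≤ m →
                 ∑ (suc (b ∸ a)) (λ l → ι ((b ∸ a) C l) * (p ^ (suc m ∸ (a ℕ.+ l)) * q ^ (a ℕ.+ l ∸ a)))
                   ≈ p ^ (suc m ∸ b)
    ∑-U-window m {a} {b} a≤b b≤m = begin
      ∑ (suc s) (λ l → ι (s C l) * (p ^ (suc m ∸ (a ℕ.+ l)) * q ^ (a ℕ.+ l ∸ a)))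
        ≈⟨ ∑-cong (suc s) (λ { l (s≤s l≤s) → term l≤s }) ⟩
      ∑ (suc s) (λ l → ι (s C l) * (q ^ l * p ^ (s ∸ l)) * p ^ (suc m ∸ b))
        ≈⟨ *-distribʳ-∑ (suc s) (p ^ (suc m ∸ b)) (λ l → ι (s C l) * (q ^ l * p ^ (s ∸ l))) ⟨
      ∑ (suc s) (λ l → ι (s C l) * (q ^ l * p ^ (s ∸ l))) * p ^ (suc m ∸ b)
        ≈⟨ *-congʳ (binomial-theorem s q p) ⟩
      (q + p) ^ s * p ^ (suc m ∸ b)
        ≈⟨ *-congʳ (trans (^-congˡ s q+p≈1) (1^n≈1 s)) ⟩
      1# * p ^ (suc m ∸ b)
        ≈⟨ *-identityˡ _ ⟩
      p ^ (suc m ∸ b) ∎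
      where
      s = b ∸ a
      term : ∀ {l} → l ≤ s → ι (s C l) * (p ^ (suc m ∸ (a ℕ.+ l)) * q ^ (a ℕ.+ l ∸ a))
                               ≈ ι (s C l) * (q ^ l * p ^ (s ∸ l)) * p ^ (suc m ∸ b)
      term {l} l≤s = begin
        ι (s C l) * (p ^ (suc m ∸ (a ℕ.+ l)) * q ^ (a ℕ.+ l ∸ a))
          ≡⟨ ≡.cong₂ (λ e f → ι (s C l) * (p ^ e * q ^ f)) exponent (m+n∸m≡n a l) ⟩
        ι (s C l) * (p ^ (s ∸ l ℕ.+ (suc m ∸ b)) * q ^ l)
          ≈⟨ *-congˡ (*-congʳ (^-homo-* p (s ∸ l) (suc m ∸ b))) ⟩
        ι (s C l) * (p ^ (s ∸ l) * p ^ (suc m ∸ b) * q ^ l)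
          ≈⟨ *-congˡ (xy∙z≈zx∙y _ _ _) ⟩
        ι (s C l) * (q ^ l * p ^ (s ∸ l) * p ^ (suc m ∸ b))
          ≈⟨ *-assoc _ _ _ ⟨
        ι (s C l) * (q ^ l * p ^ (s ∸ l)) * p ^ (suc m ∸ b) ∎
        where
        a+l≤b : a ℕ.+ l ≤ b
        a+l≤b = ≤-trans (+-monoʳ-≤ a l≤s) (≤-reflexive (m+[n∸m]≡n a≤b))
        exponent : suc m ∸ (a ℕ.+ l) ≡ s ∸ l ℕ.+ (suc m ∸ b)
        exponent = ≡.trans (≡.cong (_∸ (a ℕ.+ l)) (≡.sym (m+[n∸m]≡n (m≤n⇒m≤1+n b≤m))))
                 (≡.trans (+-∸-comm (suc m ∸ b) a+l≤b)
                          (≡.cong (ℕ._+ (suc m ∸ b)) (≡.sym (∸-+-assoc b a l))))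

    U⊙P-column : ∀ m (j : Fin (suc m)) i →
                 (U m p q ⊙ (λ i → P m i j)) i ≈ p ^ (suc m ∸ toℕ j) * P m i j
    U⊙P-column m j i = begin
      (U m p q ⊙ (λ i → P m i j)) i
        ≡⟨ sum≡∑ (suc m) _ ⟩
      ∑ (suc m) (λ k → (binom m a k ·ℕ W k) * ι (binom m k b))
        ≈⟨ ∑-cong (suc m) (λ k _ → trans (*-congʳ (×≈ι* (binom m a k) _)) (xy∙z≈xz∙y _ _ _)) ⟩
      ∑ (suc m) (λ k → ι (binom m a k) * ι (binom m k b) * W k)
        ≈⟨ ∑-binom-binom {i = a} b≤m W ⟩
      ι (binom m a b) * ∑ (suc (b ∸ a)) (λ l → ι ((b ∸ a) C l) * W (a ℕ.+ l))
        ≈⟨ ι-binom*-cong m a b (λ a≤b → ∑-U-window m a≤b b≤m) ⟩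
      ι (binom m a b) * p ^ (suc m ∸ b)
        ≈⟨ *-comm _ _ ⟩
      p ^ (suc m ∸ b) * ι (binom m a b) ∎
      where
      a = toℕ i
      b = toℕ j
      W : ℕ → Carrier
      W k = p ^ (suc m ∸ k) * q ^ (k ∸ a)
      b≤m : b ≤ m
      b≤m = toℕ≤pred[n] j

  P-column-nonzero : ¬ (1# ≈ 0#) → ∀ m (j : Fin (suc m)) → ¬ (∀ i → P m i j ≈ 0#)
  P-column-nonzero 1≉0 m j column≈0 = 1≉0 (begin
    1#      ≈⟨ ×-homo-1 1# ⟨
    ι 1     ≡⟨ ≡.cong ι (binom-diag m (toℕ j)) ⟨
    P m j j ≈⟨ column≈0 j ⟩
    0#      ∎)

  P-invertible : ∀ m → IsInvertible (P m)
  P-invertible m = Pinv m , P⊗Pinv≈𝟙 m , Pinv⊗P≈𝟙 m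

  P-column-eigenvector : ¬ (1# ≈ 0#) → ∀ {p q} → q ≈ 1# - p → ∀ m j →
                         IsEigenvector (U m p q) (λ i → P m i j)
  P-column-eigenvector 1≉0 {p} q≈1-p m j =
    P-column-nonzero 1≉0 m j , p ^ (suc m ∸ toℕ j) , U⊙P-column q≈1-p m j

lemma1 : ∀ {c ℓ} (R : CommutativeRing c ℓ) → let open CommutativeRing R in let open Matrices R in
         ¬ (1# ≈ 0#) → (p q : Carrier) → q ≈ 1# - p → (m : ℕ) → m ≥ 1 →
         IsModalMatrix (U m p q) (P m) × ((P m ⊗ Pinv m) ≈ᴹ 𝟙 × (Pinv m ⊗ P m) ≈ᴹ 𝟙)
lemma1 R 1≉0 p q q≈1-p m _ =
  (P-invertible m , P-column-eigenvector 1≉0 q≈1-p m) , P⊗Pinv≈𝟙 m , Pinv⊗P≈𝟙 m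
  where open BinomialMatrices R
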